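{- Let $G$ be a graph isomorphic to $C(\pi)$ for some $\pi\in\mathcal{S}_n$. Then $G$ is isomorphic to $C(\sigma)$ for some $\sigma\in\mathcal{S}_n(132)$ if and only if $G$ does not contain the path $P_3$ (the path with $4$ vertices and $3$ edges) as an induced subgraph.
   Context: For $\pi=\pi_1\cdots\pi_n\in\mathcal{S}_n$, $C(\pi)$ is the simple graph on vertex set $\{1,\dots,n\}$ in which distinct $i,j$ are adjacent iff there exists $k$ with $k<i$, $k<j$, $\pi_k<\pi_i$ and $\pi_k<\pi_j$; equivalently, it is the competition graph of the digraph $D(\pi)$ on the points $(i,\pi_i)$ with an arc from $(j,\pi_j)$ to $(i,\pi_i)$ whenever $i<j$ and $\pi_i<\pi_j$. $\mathcal{S}_n(132)$ is the set of permutations in $\mathcal{S}_n$ with no subsequence order-isomorphic to $132$. -}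

module Defs where

open import Data.Nat using (ℕ)
open import Data.Fin using (Fin; _<_)
open import Data.Fin.Permutation using (Permutation′; _⟨$⟩ʳ_)
open import Data.Product using (Σ; ∃; _×_; _,_)
open import Function.Bundles using (_↔_; _⇔_; Inverse)
open import Relation.Binary.PropositionalEquality using (_≡_; _≢_)
open import Relation.Nullary using (¬_)

record Graph : Set₁ where
  field
    V      : Set
    Adj    : V → V → Set
    sym    : ∀ {u v} → Adj u v → Adj v u
    irrefl : ∀ {u} → ¬ Adj u u
open Graph public

_≅_ : Graph → Graph → Set
G ≅ H = Σ (V G ↔ V H) λ f →
  ∀ u v → (Adj G u v ⇔ Adj H (Inverse.to f u) (Inverse.to f v))

-- Positions 1..n are represented by Fin n (0..n-1); order is preserved.
-- C(π): i ≠ j adjacent iff ∃ k < i, k < j with π k < π i and π k < π j.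
CAdj : ∀ {n} → Permutation′ n → Fin n → Fin n → Set
CAdj π i j = i ≢ j × ∃ λ k → k < i × k < j × (π ⟨$⟩ʳ k) < (π ⟨$⟩ʳ i) × (π ⟨$⟩ʳ k) < (π ⟨$⟩ʳ j)

C : ∀ {n} → Permutation′ n → Graph
C π = record
  { V = Fin _
  ; Adj = CAdj π
  ; sym = λ { (i≢j , k , k<i , k<j , a , b) → (λ e → i≢j (symm e)) , k , k<j , k<i , b , a }
  ; irrefl = λ { (i≢i , _) → i≢i refl' }
  }
  where
    open import Relation.Binary.PropositionalEquality using () renaming (sym to symm; refl to refl')

Contains132 : ∀ {n} → Permutation′ n → Set
Contains132 π = ∃ λ i → ∃ λ j → ∃ λ k →
  i < j × j < k × (π ⟨$⟩ʳ i) < (π ⟨$⟩ʳ k) × (π ⟨$⟩ʳ k) < (π ⟨$⟩ʳ j)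

Avoids132 : ∀ {n} → Permutation′ n → Set
Avoids132 π = ¬ Contains132 π

HasInducedP3 : Graph → Set
HasInducedP3 G = ∃ λ a → ∃ λ b → ∃ λ c → ∃ λ d →
  (a ≢ b × a ≢ c × a ≢ d × b ≢ c × b ≢ d × c ≢ d) ×
  (Adj G a b × Adj G b c × Adj G c d) ×
  (¬ Adj G a c × ¬ Adj G b d × ¬ Adj G a d)

module Submission where

-- Only if: the later neighbours of a vertex of C(σ) form a clique, and in a
-- 132-avoider the centre of an induced path u – v – w comes after both ends
-- (an increasing induced path is a 132 pattern).  The two overlapping paths
-- a – b – c and b – c – d of an induced P₃ would force c < b < c.
--
-- If: a switching argument.  Two switches keep the graph up to isomorphism
-- under side conditions and strictly increase the potential Σₜ t·π(t):
-- exchanging consecutive values that appear in decreasing order, and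
-- exchanging two adjacent positions forming a descent.  The progress lemma
-- shows that a permutation containing 132 whose graph has no induced P₃
-- always admits a valid switch; it uses a discrete intermediate value
-- theorem and the absence of induced 4-cycles in C(π).  As the potential is
-- bounded by n³, well-founded iteration ends in a 132-avoider.

open import Defs
open import Data.Nat as ℕ using (ℕ; zero; suc; _+_; _*_; _∸_)
import Data.Nat.Properties as ℕₚ
open import Data.Nat.Induction using (<-wellFounded)
open import Data.Nat.Solver using (module +-*-Solver)
open import Data.Fin using (Fin; toℕ; fromℕ<; _<_; _≤_)
import Data.Fin as Fin
open import Data.Fin.Properties
  using (any?; _≟_; _<?_; _≤?_; <-cmp; ≤∧≢⇒<; <⇒≢; toℕ-injective; toℕ<n; toℕ-fromℕ<; punchInᵢ≢i)
open import Data.Fin.Permutation using (Permutation′; _⟨$⟩ʳ_; _⟨$⟩ˡ_; inverseˡ; inverseʳ; transpose; _∘ₚ_)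
import Data.Fin.Permutation.Components as Components
open import Data.Vec.Functional using (updateAt; removeAt)
open import Data.Vec.Functional.Properties using (updateAt-updates; updateAt-minimal)
open import Algebra.Properties.CommutativeMonoid.Sum ℕₚ.+-0-commutativeMonoid using (sum; sum-remove; sum-cong-≗)
open import Data.Product using (∃; ∃₂; _×_; _,_; proj₁; proj₂)
open import Data.Empty using (⊥; ⊥-elim)
open import Function.Base using (_∘_; _∘′_)
open import Function.Bundles using (_⇔_; Inverse; mk⇔; Equivalence)
open import Function.Construct.Composition using (_↔-∘_)
open import Function.Construct.Identity using (↔-id)
open import Function.Construct.Symmetry using (↔-sym)
open import Induction.WellFounded using (Acc; acc)
open import Relation.Binary.Definitions using (tri<; tri≈; tri>)
open import Relation.Binary.PropositionalEquality as ≡ using (_≡_; _≢_; refl; cong; subst; subst₂)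
open import Relation.Nullary using (¬_; Dec; yes; no)
open import Relation.Nullary.Decidable using (_×-dec_; ¬?)
open import Relation.Unary using (Pred; Decidable)
open +-*-Solver using (solve; _:+_; _:*_; _:=_; con)

≅-refl : ∀ {G} → G ≅ G
≅-refl = ↔-id _ , λ u v → mk⇔ (λ e → e) (λ e → e)

≅-trans : ∀ {G H K} → G ≅ H → H ≅ K → G ≅ K
≅-trans (f , f-adj) (g , g-adj) = (g ↔-∘ f) , λ u v →
  mk⇔ (Equivalence.to (g-adj _ _) ∘ Equivalence.to (f-adj u v))
      (Equivalence.from (f-adj u v) ∘ Equivalence.from (g-adj _ _))

≅-sym : ∀ {G H} → G ≅ H → H ≅ G
≅-sym {G} {H} (f , f-adj) = ↔-sym f , λ x y →
  mk⇔ (λ e → Equivalence.from (f-adj (from x) (from y)) (subst₂ (Adj H) (≡.sym (back x)) (≡.sym (back y)) e))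
      (λ e → subst₂ (Adj H) (back x) (back y) (Equivalence.to (f-adj (from x) (from y)) e))
  where
  open Inverse f using (from)
  back : ∀ x → Inverse.to f (from x) ≡ x
  back = Inverse.strictlyInverseˡ f

P3-transfer : ∀ {G H} → G ≅ H → HasInducedP3 G → HasInducedP3 H
P3-transfer {G} {H} (f , f-adj)
  (a , b , c , d , (ab , ac , ad , bc , bd , cd) , (eab , ebc , ecd) , (nac , nbd , nad)) =
  to a , to b , to c , to d ,
  (distinct ab , distinct ac , distinct ad , distinct bc , distinct bd , distinct cd) ,
  (edge eab , edge ebc , edge ecd) ,
  (non-edge nac , non-edge nbd , non-edge nad)
  where
  open Inverse f using (to; from)
  distinct : ∀ {x y} → x ≢ y → to x ≢ to y
  distinct x≢y e = x≢y (≡.trans (≡.sym (Inverse.strictlyInverseʳ f _)) (≡.trans (cong from e) (Inverse.strictlyInverseʳ f _)))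
  edge : ∀ {x y} → Adj G x y → Adj H (to x) (to y)
  edge = Equivalence.to (f-adj _ _)
  non-edge : ∀ {x y} → ¬ Adj G x y → ¬ Adj H (to x) (to y)
  non-edge ¬e = ¬e ∘ Equivalence.from (f-adj _ _)

SmallerBefore : ∀ {n} → Permutation′ n → Fin n → Fin n → Set
SmallerBefore π r x = ∃ λ t → t < r × π ⟨$⟩ʳ t < π ⟨$⟩ʳ x

-- r is not a left-to-right minimum of π.  A left-to-right minimum has no
-- possible edge witness, so it is an isolated vertex of C(π).
NonLRMin : ∀ {n} → Permutation′ n → Fin n → Set
NonLRMin π r = SmallerBefore π r r

module Adjacency {n : ℕ} (π : Permutation′ n) where

  private
    p : Fin n → Fin n
    p = π ⟨$⟩ʳ_

  π-injective : ∀ {x y} → p x ≡ p y → x ≡ y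
  π-injective {x} {y} e = ≡.trans (≡.sym (inverseˡ π)) (≡.trans (cong (π ⟨$⟩ˡ_) e) (inverseˡ π))

  smallerBefore? : ∀ r x → Dec (SmallerBefore π r x)
  smallerBefore? r x = any? λ t → (t <? r) ×-dec (p t <? p x)

  nonLRMin? : ∀ r → Dec (NonLRMin π r)
  nonLRMin? r = smallerBefore? r r

  adjacent? : ∀ u v → Dec (CAdj π u v)
  adjacent? u v = ¬? (u ≟ v) ×-dec any? (λ k → (k <? u) ×-dec ((k <? v) ×-dec ((p k <? p u) ×-dec (p k <? p v))))

  adjacent-sym : ∀ {u v} → CAdj π u v → CAdj π v u
  adjacent-sym = Graph.sym (C π)

  before-LRMin : ∀ {r t} → ¬ NonLRMin π r → t < r → p r < p t
  before-LRMin {r} {t} ¬lr t<r with p t <? p r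
  ... | yes pt<pr = ⊥-elim (¬lr (t , t<r , pt<pr))
  ... | no pt≮pr = ≤∧≢⇒< (ℕₚ.≮⇒≥ pt≮pr) (λ e → <⇒≢ t<r (π-injective (≡.sym e)))

  LRMin-precedes-smaller : ∀ {r x} → ¬ NonLRMin π r → p x < p r → r < x
  LRMin-precedes-smaller {r} {x} ¬lr px<pr with <-cmp r x
  ... | tri< r<x _ _ = r<x
  ... | tri≈ _ refl _ = ⊥-elim (ℕₚ.<-irrefl refl px<pr)
  ... | tri> _ _ x<r = ⊥-elim (¬lr (x , x<r , px<pr))

  -- Two values with smaller values before r share such a witness: the
  -- smaller of the two witnesses.
  common-smaller : ∀ {r x y} → SmallerBefore π r x → SmallerBefore π r y →
                   ∃ λ k → k < r × p k < p x × p k < p y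
  common-smaller (t , t<r , pt<px) (s , s<r , ps<py) with <-cmp (p t) (p s)
  ... | tri< pt<ps _ _ = t , t<r , pt<px , ℕₚ.<-trans pt<ps ps<py
  ... | tri≈ _ pt≡ps _ = t , t<r , pt<px , subst (λ z → z < p _) (≡.sym pt≡ps) ps<py
  ... | tri> _ _ ps<pt = s , s<r , ℕₚ.<-trans ps<pt pt<px , ps<py

  later-neighbours-adjacent : ∀ {w x z} → w < x → w < z → CAdj π w x → CAdj π w z → x ≢ z → CAdj π x z
  later-neighbours-adjacent w<x w<z (_ , t , t<w , _ , _ , pt<px) (_ , s , s<w , _ , _ , ps<pz) x≢z
    with common-smaller (t , t<w , pt<px) (s , s<w , ps<pz)
  ... | k , k<w , pk<px , pk<pz = x≢z , k , ℕₚ.<-trans k<w w<x , ℕₚ.<-trans k<w w<z , pk<px , pk<pz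

  centre-not-earliest : ∀ {w x z} → CAdj π w x → CAdj π w z → ¬ CAdj π x z → x ≢ z → w < x → w < z → ⊥
  centre-not-earliest wx wz ¬xz x≢z w<x w<z = ¬xz (later-neighbours-adjacent w<x w<z wx wz x≢z)

  -- C(π) has no induced 4-cycle w – x – y – z – w: its earliest vertex would
  -- be the centre of an induced path.
  no-induced-C4 : ∀ {w x y z} → CAdj π w x → CAdj π x y → CAdj π y z → CAdj π z w →
                  ¬ CAdj π w y → ¬ CAdj π x z → x ≢ z → w ≢ y → ⊥
  no-induced-C4 {w} {x} {y} {z} wx xy yz zw ¬wy ¬xz x≢z w≢y with <-cmp w x | <-cmp w z
  ... | tri≈ _ w≡x _ | _ = proj₁ wx w≡x
  ... | _ | tri≈ _ w≡z _ = proj₁ zw (≡.sym w≡z)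
  ... | tri< w<x _ _ | tri< w<z _ _ = centre-not-earliest wx (adjacent-sym zw) ¬xz x≢z w<x w<z
  ... | tri> _ _ x<w | _ = x-before-w x<w
    where
    x-before-w : x < w → ⊥
    x-before-w x<w with <-cmp x y
    ... | tri≈ _ x≡y _ = proj₁ xy x≡y
    ... | tri< x<y _ _ = centre-not-earliest (adjacent-sym wx) xy ¬wy w≢y x<w x<y
    ... | tri> _ _ y<x with <-cmp y z
    ...   | tri≈ _ y≡z _ = proj₁ yz y≡z
    ...   | tri< y<z _ _ = centre-not-earliest (adjacent-sym xy) yz ¬xz x≢z y<x y<z
    ...   | tri> _ _ z<y = centre-not-earliest (adjacent-sym yz) zw (¬wy ∘′ adjacent-sym) (w≢y ∘′ ≡.sym)
                             z<y (ℕₚ.<-trans z<y (ℕₚ.<-trans y<x x<w))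
  ... | tri< _ _ _ | tri> _ _ z<w = z-before-w z<w
    where
    z-before-w : z < w → ⊥
    z-before-w z<w with <-cmp z y
    ... | tri≈ _ z≡y _ = proj₁ yz (≡.sym z≡y)
    ... | tri< z<y _ _ = centre-not-earliest (adjacent-sym yz) zw (¬wy ∘′ adjacent-sym) (w≢y ∘′ ≡.sym) z<y z<w
    ... | tri> _ _ y<z with <-cmp y x
    ...   | tri≈ _ y≡x _ = proj₁ xy (≡.sym y≡x)
    ...   | tri< y<x _ _ = centre-not-earliest (adjacent-sym xy) yz ¬xz x≢z y<x y<z
    ...   | tri> _ _ x<y = centre-not-earliest (adjacent-sym wx) xy ¬wy w≢y
                             (ℕₚ.<-trans x<y (ℕₚ.<-trans y<z z<w)) x<y

  increasing-induced-path⇒132 : ∀ {u v w} → u < v → v < w → CAdj π u v → CAdj π v w → ¬ CAdj π u w →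
                                Contains132 π
  increasing-induced-path⇒132 {u} {v} {w} u<v v<w (_ , s , s<u , _ , ps<pu , ps<pv) (_ , t , t<v , _ , pt<pv , pt<pw) ¬uw
    with p s <? p w
  ... | yes ps<pw = ⊥-elim (¬uw (<⇒≢ u<w , s , s<u , ℕₚ.<-trans s<u u<w , ps<pu , ps<pw))
    where u<w = ℕₚ.<-trans u<v v<w
  ... | no ps≮pw = t , v , w , t<v , v<w , pt<pw , ℕₚ.≤-<-trans (ℕₚ.≮⇒≥ ps≮pw) ps<pv

  centre-after-end : Avoids132 π → ∀ {u v w} → CAdj π u v → CAdj π v w → ¬ CAdj π u w → u ≢ w → w < v
  centre-after-end av {u} {v} {w} uv vw ¬uw u≢w with <-cmp v w
  ... | tri≈ _ v≡w _ = ⊥-elim (proj₁ vw v≡w)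
  ... | tri> _ _ w<v = w<v
  ... | tri< v<w _ _ with <-cmp u v
  ...   | tri≈ _ u≡v _ = ⊥-elim (proj₁ uv u≡v)
  ...   | tri< u<v _ _ = ⊥-elim (av (increasing-induced-path⇒132 u<v v<w uv vw ¬uw))
  ...   | tri> _ _ v<u = ⊥-elim (centre-not-earliest (adjacent-sym uv) vw ¬uw u≢w v<u v<w)

  -- Hence C(σ) has no induced P₃ a – b – c – d for a 132-avoider σ: the
  -- path a – b – c forces c < b, the path b – c – d forces b < c.
  avoider⇒P3-free : Avoids132 π → ¬ HasInducedP3 (C π)
  avoider⇒P3-free av (a , b , c , d , (_ , a≢c , _ , _ , b≢d , _) , (ab , bc , cd) , (¬ac , ¬bd , _)) =
    ℕₚ.<-asym (centre-after-end av ab bc ¬ac a≢c)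
              (centre-after-end av (adjacent-sym cd) (adjacent-sym bc) (¬bd ∘′ adjacent-sym) (b≢d ∘′ ≡.sym))

_⋖_ : ∀ {n} → Fin n → Fin n → Set
a ⋖ b = toℕ b ≡ suc (toℕ a)

module _ {n : ℕ} where

  ⋖⇒< : ∀ {a b : Fin n} → a ⋖ b → a < b
  ⋖⇒< {a} a⋖b = subst (toℕ a ℕ.<_) (≡.sym a⋖b) (ℕₚ.n<1+n (toℕ a))

  ⋖-above : ∀ {a b t : Fin n} → a ⋖ b → a < t → t ≢ b → b < t
  ⋖-above {t = t} a⋖b a<t t≢b = ≤∧≢⇒< (subst (ℕ._≤ toℕ t) (≡.sym a⋖b) a<t) (t≢b ∘′ ≡.sym)

  ⋖-below : ∀ {a b t : Fin n} → a ⋖ b → t < b → t ≢ a → t < a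
  ⋖-below {t = t} a⋖b t<b t≢a = ≤∧≢⇒< (ℕₚ.≤-pred (subst (toℕ t ℕ.<_) a⋖b t<b)) t≢a

  successor : ∀ {a k : Fin n} → a < k → ∃ λ b → a ⋖ b × b ≤ k
  successor {a} {k} a<k = fromℕ< (ℕₚ.<-≤-trans (ℕ.s≤s a<k) (toℕ<n k)) ,
                          toℕ-fromℕ< _ , subst (ℕ._≤ toℕ k) (≡.sym (toℕ-fromℕ< _)) a<k

  crossing : ∀ {ℓ} {Φ : Pred (Fin n) ℓ} → Decidable Φ → ∀ {j k} → j ≤ k → Φ j → ¬ Φ k →
             ∃₂ λ a b → a ⋖ b × j ≤ a × b ≤ k × Φ a × ¬ Φ b
  crossing {Φ = Φ} Φ? {j} {k} j≤k Φj ¬Φk = walk (toℕ k ∸ toℕ j) j (ℕₚ.m+[n∸m]≡n j≤k) ℕₚ.≤-refl Φj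
    where
    walk : ∀ d r → toℕ r + d ≡ toℕ k → j ≤ r → Φ r → ∃₂ λ a b → a ⋖ b × j ≤ a × b ≤ k × Φ a × ¬ Φ b
    walk zero r r≡k _ Φr = ⊥-elim (¬Φk (subst Φ (toℕ-injective (≡.trans (≡.sym (ℕₚ.+-identityʳ _)) r≡k)) Φr))
    walk (suc d) r r+d≡k j≤r Φr with successor {r} {k} (subst (toℕ r ℕ.<_) r+d≡k (ℕₚ.m<m+n (toℕ r) ℕ.z<s))
    ... | s , r⋖s , s≤k with Φ? s
    ...   | no ¬Φs = r , s , r⋖s , j≤r , s≤k , Φr , ¬Φs
    ...   | yes Φs = walk d s (≡.trans (cong (_+ d) r⋖s) (≡.trans (≡.sym (ℕₚ.+-suc (toℕ r) d)) r+d≡k))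
                       (ℕₚ.≤-trans j≤r (ℕₚ.<⇒≤ (⋖⇒< r⋖s))) Φs

module AdjacentTransposition {n : ℕ} {X X' : Fin n} (X⋖X' : X ⋖ X') where

  τ : Fin n → Fin n
  τ = Components.transpose X X'

  X<X' : X < X'
  X<X' = ⋖⇒< X⋖X'

  τ-X : τ X ≡ X'
  τ-X with X ≟ X
  ... | yes _ = refl
  ... | no X≢X = ⊥-elim (X≢X refl)

  τ-X' : τ X' ≡ X
  τ-X' with X' ≟ X
  ... | yes X'≡X = ⊥-elim (<⇒≢ X<X' (≡.sym X'≡X))
  ... | no _ with X' ≟ X'
  ...   | yes _ = refl
  ...   | no X'≢X' = ⊥-elim (X'≢X' refl)

  τ-other : ∀ {t} → t ≢ X → t ≢ X' → τ t ≡ t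
  τ-other {t} t≢X t≢X' with t ≟ X
  ... | yes t≡X = ⊥-elim (t≢X t≡X)
  ... | no _ with t ≟ X'
  ...   | yes t≡X' = ⊥-elim (t≢X' t≡X')
  ...   | no _ = refl

  data Place (t : Fin n) : Set where
    at-X     : t ≡ X → Place t
    at-X'    : t ≡ X' → Place t
    elsewhere : t ≢ X → t ≢ X' → Place t

  place : ∀ t → Place t
  place t with t ≟ X | t ≟ X'
  ... | yes t≡X | _ = at-X t≡X
  ... | no _ | yes t≡X' = at-X' t≡X'
  ... | no t≢X | no t≢X' = elsewhere t≢X t≢X'

  -- Deciding the place of t without exposing the comparisons made inside τ.
  is-X? : ∀ t → Dec (t ≡ X)
  is-X? t with place t
  ... | at-X t≡X = yes t≡X
  ... | at-X' t≡X' = no λ t≡X → <⇒≢ X<X' (≡.trans (≡.sym t≡X) t≡X')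
  ... | elsewhere t≢X _ = no t≢X

  is-X'? : ∀ t → Dec (t ≡ X')
  is-X'? t with place t
  ... | at-X t≡X = no λ t≡X' → <⇒≢ X<X' (≡.trans (≡.sym t≡X) t≡X')
  ... | at-X' t≡X' = yes t≡X'
  ... | elsewhere _ t≢X' = no t≢X'

  τ-involutive : ∀ t → τ (τ t) ≡ t
  τ-involutive t with place t
  ... | at-X refl = ≡.trans (cong τ τ-X) τ-X'
  ... | at-X' refl = ≡.trans (cong τ τ-X') τ-X
  ... | elsewhere t≢X t≢X' = ≡.trans (cong τ (τ-other t≢X t≢X')) (τ-other t≢X t≢X')

  τ-monotone : ∀ {t u} → t < u → ¬ (t ≡ X × u ≡ X') → τ t < τ u
  τ-monotone {t} {u} t<u not-pair with place t | place u
  ... | at-X refl | at-X refl = ⊥-elim (ℕₚ.<-irrefl refl t<u)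
  ... | at-X refl | at-X' refl = ⊥-elim (not-pair (refl , refl))
  ... | at-X refl | elsewhere u≢X u≢X' rewrite τ-X | τ-other u≢X u≢X' = ⋖-above X⋖X' t<u u≢X'
  ... | at-X' refl | at-X refl = ⊥-elim (ℕₚ.<-asym t<u X<X')
  ... | at-X' refl | at-X' refl = ⊥-elim (ℕₚ.<-irrefl refl t<u)
  ... | at-X' refl | elsewhere u≢X u≢X' rewrite τ-X' | τ-other u≢X u≢X' = ℕₚ.<-trans X<X' t<u
  ... | elsewhere t≢X t≢X' | at-X refl rewrite τ-X | τ-other t≢X t≢X' = ℕₚ.<-trans t<u X<X'
  ... | elsewhere t≢X t≢X' | at-X' refl rewrite τ-X' | τ-other t≢X t≢X' = ⋖-below X⋖X' t<u t≢X
  ... | elsewhere t≢X t≢X' | elsewhere u≢X u≢X' rewrite τ-other t≢X t≢X' | τ-other u≢X u≢X' = t<u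

  τ-reflects : ∀ {t u} → τ t < τ u → ¬ (t ≡ X' × u ≡ X) → t < u
  τ-reflects {t} {u} τt<τu not-pair =
    subst₂ _<_ (τ-involutive t) (τ-involutive u) (τ-monotone τt<τu not-swapped)
    where
    not-swapped : ¬ (τ t ≡ X × τ u ≡ X')
    not-swapped (τt≡X , τu≡X') =
      not-pair ( ≡.trans (≡.sym (τ-involutive t)) (≡.trans (cong τ τt≡X) τ-X)
               , ≡.trans (≡.sym (τ-involutive u)) (≡.trans (cong τ τu≡X') τ-X'))


sum-update : ∀ {n} (f g : Fin n → ℕ) (a : Fin n) → (∀ t → t ≢ a → f t ≡ g t) →
             sum f + g a ≡ sum g + f a
sum-update {suc n} f g a f≡g = begin
  sum f + g a                    ≡⟨ cong (_+ g a) (sum-remove {i = a} f) ⟩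
  f a + sum (removeAt f a) + g a ≡⟨ cong (λ s → f a + s + g a) (sum-cong-≗ λ t → f≡g _ (punchInᵢ≢i a t)) ⟩
  f a + sum (removeAt g a) + g a ≡⟨ solve 3 (λ x s y → x :+ s :+ y := y :+ s :+ x) refl (f a) _ (g a) ⟩
  g a + sum (removeAt g a) + f a ≡⟨ cong (_+ f a) (≡.sym (sum-remove {i = a} g)) ⟩
  sum g + f a                    ∎
  where open ≡.≡-Reasoning

sum-exchange : ∀ {n} (f g : Fin n → ℕ) {a b} → a ≢ b → (∀ t → t ≢ a → t ≢ b → f t ≡ g t) →
               f a + f b ℕ.< g a + g b → sum f ℕ.< sum g
sum-exchange f g {a} {b} a≢b f≡g growth = ℕₚ.+-cancelʳ-< (f a + f b) (sum f) (sum g) (begin-strict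
  sum f + (f a + f b)  <⟨ ℕₚ.+-monoʳ-< (sum f) growth ⟩
  sum f + (g a + g b)  ≡⟨ ≡.sym (ℕₚ.+-assoc (sum f) (g a) (g b)) ⟩
  sum f + g a + g b    ≡⟨ cong (_+ g b) (≡.trans (cong (sum f +_) (≡.sym h-a)) (sum-update f h a f≡h)) ⟩
  sum h + f a + g b    ≡⟨ solve 3 (λ s x y → s :+ x :+ y := s :+ y :+ x) refl (sum h) (f a) (g b) ⟩
  sum h + g b + f a    ≡⟨ cong (_+ f a) (≡.trans (sum-update h g b h≡g) (cong (sum g +_) h-b)) ⟩
  sum g + f b + f a    ≡⟨ solve 3 (λ s x y → s :+ y :+ x := s :+ (x :+ y)) refl (sum g) (f a) (f b) ⟩
  sum g + (f a + f b)  ∎)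
  where
  open ℕₚ.≤-Reasoning
  h : Fin _ → ℕ
  h = updateAt f a (λ _ → g a)
  h-a : h a ≡ g a
  h-a = updateAt-updates a f
  f≡h : ∀ t → t ≢ a → f t ≡ h t
  f≡h t t≢a = ≡.sym (updateAt-minimal t a f t≢a)
  h-b : h b ≡ f b
  h-b = updateAt-minimal b a f (λ b≡a → a≢b (≡.sym b≡a))
  h≡g : ∀ t → t ≢ b → h t ≡ g t
  h≡g t t≢b with t ≟ a
  ... | yes refl = h-a
  ... | no t≢a = ≡.trans (≡.sym (f≡h t t≢a)) (f≡g t t≢a t≢b)

sum-bounded : ∀ {n} (f : Fin n → ℕ) (B : ℕ) → (∀ t → f t ℕ.≤ B) → sum f ℕ.≤ n * B
sum-bounded {zero} f B f≤B = ℕ.z≤n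
sum-bounded {suc n} f B f≤B = ℕₚ.+-mono-≤ (f≤B _) (sum-bounded (λ t → f (Fin.suc t)) B (λ t → f≤B _))

rearrangement : ∀ {a b x y} → a ℕ.< b → x ℕ.< y → a * y + b * x ℕ.< a * x + b * y
rearrangement {a} {b} {x} {y} a<b x<y with ℕₚ.m≤n⇒∃[o]m+o≡n a<b | ℕₚ.m≤n⇒∃[o]m+o≡n x<y
... | d , refl | e , refl = subst (a * y + b * x ℕ.<_) (≡.sym expand) (ℕₚ.m<m+n _ ℕ.z<s)
  where
  expand : a * x + (suc a + d) * (suc x + e) ≡ a * (suc x + e) + (suc a + d) * x + suc (d + e + d * e)
  expand = solve 4 (λ a d x e → a :* x :+ (con 1 :+ a :+ d) :* (con 1 :+ x :+ e)
                     := a :* (con 1 :+ x :+ e) :+ (con 1 :+ a :+ d) :* x :+ (con 1 :+ (d :+ e :+ d :* e)))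
                   refl a d x e

potential : ∀ {n} → Permutation′ n → ℕ
potential π = sum λ t → toℕ t * toℕ (π ⟨$⟩ʳ t)

potential-bounded : ∀ {n} (π : Permutation′ n) → potential π ℕ.≤ n * (n * n)
potential-bounded {n} π = sum-bounded _ (n * n) λ t →
  ℕₚ.*-mono-≤ (ℕₚ.<⇒≤ (toℕ<n t)) (ℕₚ.<⇒≤ (toℕ<n (π ⟨$⟩ʳ t)))

module ValueSwitch {n : ℕ} (π : Permutation′ n) {X X' : Fin n} (X⋖X' : X ⋖ X')
                 {P Q : Fin n} (πP : π ⟨$⟩ʳ P ≡ X') (πQ : π ⟨$⟩ʳ Q ≡ X) (P<Q : P < Q) where

  open AdjacentTransposition X⋖X'
  open Adjacency π using (π-injective; adjacent-sym)

  private
    p : Fin n → Fin n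
    p = π ⟨$⟩ʳ_

    at-P : ∀ {t} → p t ≡ X' → t ≡ P
    at-P e = π-injective (≡.trans e (≡.sym πP))

    at-Q : ∀ {t} → p t ≡ X → t ≡ Q
    at-Q e = π-injective (≡.trans e (≡.sym πQ))

  swapped : Permutation′ n
  swapped = π ∘ₚ transpose X X'

  -- The exchange moves the larger value to the later position.
  potential-increases : potential π ℕ.< potential swapped
  potential-increases = sum-exchange f g (<⇒≢ P<Q) unchanged growth
    where
    f g : Fin n → ℕ
    f t = toℕ t * toℕ (p t)
    g t = toℕ t * toℕ (τ (p t))
    unchanged : ∀ t → t ≢ P → t ≢ Q → f t ≡ g t
    unchanged t t≢P t≢Q = cong (λ v → toℕ t * toℕ v) (≡.sym (τ-other (t≢Q ∘′ at-Q) (t≢P ∘′ at-P)))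
    growth : f P + f Q ℕ.< g P + g Q
    growth rewrite πP | πQ | τ-X | τ-X' = rearrangement P<Q X<X'

  -- Every comparison used by an edge witness survives the exchange: only the
  -- values at P and Q are compared differently, and as P < Q that comparison
  -- is never the one between a witness and a later vertex.
  preserves : ∀ {k u} → k < u → p k < p u → τ (p k) < τ (p u)
  preserves k<u pk<pu = τ-monotone pk<pu λ (pk≡X , pu≡X') →
    ℕₚ.<-asym P<Q (subst₂ _<_ (at-Q pk≡X) (at-P pu≡X') k<u)

  reflects : ∀ {k u} → ¬ (k ≡ P × u ≡ Q) → τ (p k) < τ (p u) → p k < p u
  reflects not-PQ τpk<τpu = τ-reflects τpk<τpu λ (pk≡X' , pu≡X) → not-PQ (at-P pk≡X' , at-Q pu≡X)

  -- If Q is already adjacent to every later vertex above X', then the new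
  -- witness P creates no new edge and C(π) is unchanged.
  module _ (Q-reaches : ∀ v → P < v → v ≢ Q → X' < p v → CAdj π Q v) where

    new-witness : ∀ {v} → P < v → v ≢ Q → τ (p P) < τ (p v) → CAdj π Q v
    new-witness {v} P<v v≢Q τpP<τpv = Q-reaches v P<v v≢Q (⋖-above X⋖X' X<pv (<⇒≢ P<v ∘′ ≡.sym ∘′ at-P))
      where
      X<pv : X < p v
      X<pv = subst₂ _<_ (≡.trans (cong τ πP) τ-X') (τ-other (v≢Q ∘′ at-Q) (<⇒≢ P<v ∘′ ≡.sym ∘′ at-P)) τpP<τpv

    from-swapped : ∀ {u v} → CAdj swapped u v → CAdj π u v
    from-swapped {u} {v} (u≢v , k , k<u , k<v , a , b) with k ≟ P | u ≟ Q | v ≟ Q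
    ... | yes refl | yes refl | yes refl = ⊥-elim (u≢v refl)
    ... | yes refl | yes refl | no v≢Q   = new-witness k<v v≢Q b
    ... | yes refl | no u≢Q   | yes refl = adjacent-sym (new-witness k<u u≢Q a)
    ... | yes refl | no u≢Q   | no v≢Q   = u≢v , k , k<u , k<v , reflects (u≢Q ∘′ proj₂) a , reflects (v≢Q ∘′ proj₂) b
    ... | no k≢P   | _        | _        = u≢v , k , k<u , k<v , reflects (k≢P ∘′ proj₁) a , reflects (k≢P ∘′ proj₁) b

    same-graph : C π ≅ C swapped
    same-graph = ↔-id _ , λ u v → mk⇔
      (λ (u≢v , k , k<u , k<v , a , b) → u≢v , k , k<u , k<v , preserves k<u a , preserves k<v b)
      from-swapped

module PositionSwitch {n : ℕ} (π : Permutation′ n) {A A' : Fin n} (A⋖A' : A ⋖ A')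
                    (descent : π ⟨$⟩ʳ A' < π ⟨$⟩ʳ A) where

  open AdjacentTransposition A⋖A'
  open Adjacency π using (adjacent-sym; common-smaller)

  private
    p : Fin n → Fin n
    p = π ⟨$⟩ʳ_

  swapped : Permutation′ n
  swapped = transpose A A' ∘ₚ π

  -- The exchange moves the larger value to the later position.
  potential-increases : potential π ℕ.< potential swapped
  potential-increases = sum-exchange f g (<⇒≢ X<X') unchanged growth
    where
    f g : Fin n → ℕ
    f t = toℕ t * toℕ (p t)
    g t = toℕ t * toℕ (p (τ t))
    unchanged : ∀ t → t ≢ A → t ≢ A' → f t ≡ g t
    unchanged t t≢A t≢A' = cong (λ s → toℕ t * toℕ (p s)) (≡.sym (τ-other t≢A t≢A'))
    growth : f A + f A' ℕ.< g A + g A'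
    growth rewrite τ-X | τ-X' = rearrangement X<X' descent

  -- Positions keep their relative order except for A and A': the witness A
  -- for A' (impossible, by the descent) would be lost, the witness A' for A
  -- is gained.
  preserves : ∀ {k u} → k < u → p k < p u → τ k < τ u
  preserves k<u pk<pu = τ-monotone k<u λ { (refl , refl) → ℕₚ.<-asym descent pk<pu }

  reflects : ∀ {k u} → ¬ (k ≡ A' × u ≡ A) → τ k < τ u → k < u
  reflects not-pair τk<τu = τ-reflects τk<τu not-pair

  -- If A is no left-to-right minimum and every later value above π(A') already
  -- has a smaller value before A, then the gained witness creates no new edge
  -- and τ is an isomorphism C(π) ≅ C(swapped).
  module _ (A-non-min : NonLRMin π A) (covered : ∀ v → A' < v → p A' < p v → SmallerBefore π A v) where

    A'<v : ∀ {v} → v ≢ A → τ A' < τ v → A' < v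
    A'<v {v} v≢A τA'<τv = ⋖-above A⋖A' (subst₂ _<_ τ-X' (τ-other v≢A v≢A') τA'<τv) v≢A'
      where
      v≢A' : v ≢ A'
      v≢A' refl = ℕₚ.<-irrefl refl τA'<τv

    new-witness : ∀ {v} → v ≢ A → τ A' < τ v → p A' < p v → CAdj π A v
    new-witness {v} v≢A τA'<τv pA'<pv with common-smaller A-non-min (covered v (A'<v v≢A τA'<τv) pA'<pv)
    ... | k , k<A , pk<pA , pk<pv =
      v≢A ∘′ ≡.sym , k , k<A , ℕₚ.<-trans k<A (ℕₚ.<-trans X<X' (A'<v v≢A τA'<τv)) , pk<pA , pk<pv

    from-witness : ∀ {u v} k → u ≢ v → τ k < τ u → τ k < τ v → p k < p u → p k < p v → CAdj π u v
    from-witness {u} {v} k u≢v a b c d with is-X'? k | is-X? u | is-X? v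
    ... | yes refl | yes refl | yes refl = ⊥-elim (u≢v refl)
    ... | yes refl | yes refl | no v≢A   = new-witness v≢A b d
    ... | yes refl | no u≢A   | yes refl = adjacent-sym (new-witness u≢A a c)
    ... | yes refl | no u≢A   | no v≢A   = u≢v , k , reflects (u≢A ∘′ proj₂) a , reflects (v≢A ∘′ proj₂) b , c , d
    ... | no k≢A'  | _        | _        = u≢v , k , reflects (k≢A' ∘′ proj₁) a , reflects (k≢A' ∘′ proj₁) b , c , d

    to-swapped : ∀ {u v} → CAdj π u v → CAdj swapped (τ u) (τ v)
    to-swapped {u} {v} (u≢v , k , k<u , k<v , a , b) =
      u≢v ∘′ τ-injective , τ k , preserves k<u a , preserves k<v b , back a , back b
      where
      τ-injective : τ u ≡ τ v → u ≡ v
      τ-injective e = ≡.trans (≡.sym (τ-involutive u)) (≡.trans (cong τ e) (τ-involutive v))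
      back : ∀ {w} → p k < p w → p (τ (τ k)) < p (τ (τ w))
      back {w} = subst₂ (λ s t → p s < p t) (≡.sym (τ-involutive k)) (≡.sym (τ-involutive w))

    from-swapped : ∀ {u v} → CAdj swapped (τ u) (τ v) → CAdj π u v
    from-swapped {u} {v} (τu≢τv , k , k<τu , k<τv , a , b) =
      from-witness (τ k) (τu≢τv ∘′ cong τ)
        (subst (_< τ u) (≡.sym (τ-involutive k)) k<τu) (subst (_< τ v) (≡.sym (τ-involutive k)) k<τv)
        (subst (λ w → p (τ k) < p w) (τ-involutive u) a) (subst (λ w → p (τ k) < p w) (τ-involutive v) b)

    same-graph : C π ≅ C swapped
    same-graph = transpose A A' , λ u v → mk⇔ to-swapped from-swapped

record Improvement {n : ℕ} (π : Permutation′ n) : Set where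
  constructor improvement
  field
    next       : Permutation′ n
    same-graph : C π ≅ C next
    increases  : potential π ℕ.< potential next

ExclusiveNeighbour : ∀ {n} → Permutation′ n → Fin n → Fin n → Set
ExclusiveNeighbour π x y = ∃ λ c → CAdj π c x × ¬ CAdj π c y × c ≢ y

module Progress {n : ℕ} (π : Permutation′ n) where

  open Adjacency π

  private
    p : Fin n → Fin n
    p = π ⟨$⟩ʳ_

  SwitchableDescent : Set
  SwitchableDescent = ∃₂ λ A A' → A ⋖ A' × p A' < p A × NonLRMin π A'

  SwitchableInversion : Set
  SwitchableInversion = ∃₂ λ P Q → p Q ⋖ p P × P < Q × NonLRMin π P

  switchable-descent? : Dec SwitchableDescent
  switchable-descent? = any? λ A → any? λ A' → (toℕ A' ℕ.≟ ℕ.suc (toℕ A)) ×-dec ((p A' <? p A) ×-dec nonLRMin? A')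

  switchable-inversion? : Dec SwitchableInversion
  switchable-inversion? = any? λ P → any? λ Q → (toℕ (p P) ℕ.≟ ℕ.suc (toℕ (p Q))) ×-dec ((P <? Q) ×-dec nonLRMin? P)

  exclusive-neighbour? : ∀ x y → Dec (ExclusiveNeighbour π x y)
  exclusive-neighbour? x y = any? λ c → adjacent? c x ×-dec (¬? (adjacent? c y) ×-dec ¬? (c ≟ y))

  -- A switchable descent can indeed be switched: the smaller entry's earlier smaller value
  -- covers everything the switch could add.
  switch-descent : SwitchableDescent → Improvement π
  switch-descent (A , A' , A⋖A' , pA'<pA , t , t<A' , pt<pA') =
    improvement swapped (same-graph (t , t<A , ℕₚ.<-trans pt<pA' pA'<pA) covered) potential-increases
    where
    open PositionSwitch π A⋖A' pA'<pA
    t<A : t < A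
    t<A = ⋖-below A⋖A' t<A' λ { refl → ℕₚ.<-asym pt<pA' pA'<pA }
    covered : ∀ v → A' < v → p A' < p v → SmallerBefore π A v
    covered v _ pA'<pv = t , t<A , ℕₚ.<-trans pt<pA' pA'<pv

  -- A switchable inversion can indeed be switched: the earlier smaller value of P makes Q
  -- adjacent to every later vertex above π(P).
  switch-inversion : SwitchableInversion → Improvement π
  switch-inversion (P , Q , pQ⋖pP , P<Q , t , t<P , pt<pP) =
    improvement swapped (same-graph Q-reaches) potential-increases
    where
    open ValueSwitch π pQ⋖pP refl refl P<Q
    Q-reaches : ∀ v → P < v → v ≢ Q → p P < p v → CAdj π Q v
    Q-reaches v P<v v≢Q pP<pv =
      v≢Q ∘′ ≡.sym , t , ℕₚ.<-trans t<P P<Q , ℕₚ.<-trans t<P P<v ,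
      ⋖-below pQ⋖pP pt<pP (<⇒≢ (ℕₚ.<-trans t<P P<Q) ∘′ π-injective) , ℕₚ.<-trans pt<pP pP<pv

  minimum-between : ¬ SwitchableDescent → ∀ {j k} → j < k → NonLRMin π j → NonLRMin π k → p k < p j →
                    ∃₂ λ a L → a ⋖ L × j ≤ a × L < k × NonLRMin π a × ¬ NonLRMin π L
  minimum-between no-descent {j} {k} j<k nl-j nl-k pk<pj
    with crossing (λ r → nonLRMin? r ×-dec (p j ≤? p r)) (ℕₚ.<⇒≤ j<k) (nl-j , ℕₚ.≤-refl)
                  (λ (_ , pj≤pk) → ℕₚ.<⇒≱ pk<pj pj≤pk)
  ... | a , L , a⋖L , j≤a , L≤k , (nl-a , pj≤pa) , ¬ΦL with nonLRMin? L
  ...   | yes nl-L = ⊥-elim (no-descent (a , L , a⋖L , ℕₚ.<-≤-trans (ℕₚ.≰⇒> (¬ΦL ∘′ (nl-L ,_))) pj≤pa , nl-L))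
  ...   | no ¬nl-L = a , L , a⋖L , j≤a , ≤∧≢⇒< L≤k (λ { refl → ¬nl-L nl-k }) , nl-a , ¬nl-L

  minimum-above : ¬ SwitchableInversion → ∀ {j k} → j < k → NonLRMin π k → p k < p j →
                  ∃₂ λ P Q → p Q ⋖ p P × ¬ NonLRMin π P × NonLRMin π Q × p k ≤ p Q × p P ≤ p j
  minimum-above no-inversion {j} {k} j<k nl-k pk<pj
    with crossing (λ x → any? λ r → (p r ≟ x) ×-dec (nonLRMin? r ×-dec (k ≤? r))) (ℕₚ.<⇒≤ pk<pj)
                  (k , refl , nl-k , ℕₚ.≤-refl)
                  (λ (r , pr≡pj , _ , k≤r) → ℕₚ.<⇒≱ j<k (subst (k ≤_) (π-injective pr≡pj) k≤r))
  ... | X , X' , X⋖X' , pk≤X , X'≤pj , (Q , refl , nl-Q , k≤Q) , ¬ΦX' =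
    P , Q , pQ⋖pP , ¬nl-P , nl-Q , pk≤X , subst (_≤ p j) (≡.sym pP≡X') X'≤pj
    where
    P : Fin n
    P = π ⟨$⟩ˡ X'
    pP≡X' : p P ≡ X'
    pP≡X' = inverseʳ π
    pQ⋖pP : p Q ⋖ p P
    pQ⋖pP = ≡.trans (cong toℕ pP≡X') X⋖X'
    ¬nl-P : ¬ NonLRMin π P
    ¬nl-P nl-P with k ≤? P
    ... | yes k≤P = ¬ΦX' (P , pP≡X' , nl-P , k≤P)
    ... | no k≰P = no-inversion (P , Q , pQ⋖pP , ℕₚ.<-≤-trans (ℕₚ.≰⇒> k≰P) k≤Q , nl-P)

  -- An edge j – k together with a neighbour of j only and a neighbour of k
  -- only gives an induced P₃; the two outer vertices are not adjacent since
  -- C(π) has no induced 4-cycle.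
  exclusive-neighbours⇒P3 : ∀ {j k} → CAdj π j k → ExclusiveNeighbour π j k → ExclusiveNeighbour π k j →
                            HasInducedP3 (C π)
  exclusive-neighbours⇒P3 {j} {k} jk (c , cj , ¬ck , c≢k) (d , dk , ¬dj , d≢j) =
    c , j , k , d ,
    (proj₁ cj , c≢k , c≢d , proj₁ jk , d≢j ∘′ ≡.sym , proj₁ dk ∘′ ≡.sym) ,
    (cj , jk , adjacent-sym dk) ,
    (¬ck , ¬dj ∘′ adjacent-sym , ¬cd)
    where
    c≢d : c ≢ d
    c≢d refl = ¬ck dk
    ¬cd : ¬ CAdj π c d
    ¬cd cd = no-induced-C4 cj jk (adjacent-sym dk) (adjacent-sym cd) ¬ck (¬dj ∘′ adjacent-sym) (d≢j ∘′ ≡.sym) c≢k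

  -- Case 1 of the progress lemma: every neighbour of k other than j is a
  -- neighbour of j.  Then the descent a ⋖ L in front of the minimum L found
  -- between j and k can be switched.
  position-switch : ¬ SwitchableDescent → ∀ {i j k} → i < j → j < k → p i < p k → p k < p j →
                    ¬ ExclusiveNeighbour π k j → Improvement π
  position-switch no-descent {i} {j} {k} i<j j<k pi<pk pk<pj no-exclusive
    with minimum-between no-descent j<k (i , i<j , ℕₚ.<-trans pi<pk pk<pj) (i , ℕₚ.<-trans i<j j<k , pi<pk) pk<pj
  ... | a , L , a⋖L , j≤a , L<k , nl-a , ¬nl-L =
    improvement swapped (same-graph nl-a covered) potential-increases
    where
    a<L : a < L
    a<L = ⋖⇒< a⋖L
    i<a : i < a
    i<a = ℕₚ.<-≤-trans i<j j≤a
    open PositionSwitch π a⋖L (before-LRMin ¬nl-L a<L)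
    -- A later vertex v above π(L) without a smaller value before a would be
    -- a neighbour of k (via L) that is not a neighbour of j.
    covered : ∀ v → L < v → p L < p v → SmallerBefore π a v
    covered v L<v pL<pv with smallerBefore? a v
    ... | yes smaller = smaller
    ... | no ¬smaller = ⊥-elim (no-exclusive (v , vk , ¬vj , v≢j))
      where
      v≢k : v ≢ k
      v≢k refl = ¬smaller (i , i<a , pi<pk)
      vk : CAdj π v k
      vk = v≢k , L , L<v , L<k , pL<pv , ℕₚ.<-trans (before-LRMin ¬nl-L (ℕₚ.<-trans i<a a<L)) pi<pk
      ¬vj : ¬ CAdj π v j
      ¬vj (_ , t , _ , t<j , pt<pv , _) = ¬smaller (t , ℕₚ.<-≤-trans t<j j≤a , pt<pv)
      v≢j : v ≢ j
      v≢j refl = ℕₚ.<-asym L<v (ℕₚ.≤-<-trans j≤a a<L)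

  -- Case 2 of the progress lemma: every neighbour of j other than k is a
  -- neighbour of k.  Then the values π(Q) ⋖ π(P) found above π(k) can be
  -- switched, the successor P₁ of P serving as the witness that makes Q
  -- adjacent to all later larger vertices.
  value-switch : ¬ SwitchableInversion → ∀ {i j k} → i < j → j < k → p i < p k → p k < p j →
                 ¬ ExclusiveNeighbour π j k → Improvement π
  value-switch no-inversion {i} {j} {k} i<j j<k pi<pk pk<pj no-exclusive
    with minimum-above no-inversion j<k (i , ℕₚ.<-trans i<j j<k , pi<pk) pk<pj
  ... | P , Q , pQ⋖pP , ¬nl-P , nl-Q , pk≤pQ , pP≤pj = switch-or-contradict (nonLRMin? P₁)
    where
    pk<pP : p k < p P
    pk<pP = ℕₚ.≤-<-trans pk≤pQ (⋖⇒< pQ⋖pP)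
    P₁-facts : ∃ λ P₁ → P ⋖ P₁ × P₁ ≤ i
    P₁-facts = successor (LRMin-precedes-smaller ¬nl-P (ℕₚ.<-trans pi<pk pk<pP))
    P₁ : Fin n
    P₁ = proj₁ P₁-facts
    P⋖P₁ : P ⋖ P₁
    P⋖P₁ = proj₁ (proj₂ P₁-facts)
    P₁≤i : P₁ ≤ i
    P₁≤i = proj₂ (proj₂ P₁-facts)
    P<P₁ : P < P₁
    P<P₁ = ⋖⇒< P⋖P₁
    P₁<k : P₁ < k
    P₁<k = ℕₚ.≤-<-trans P₁≤i (ℕₚ.<-trans i<j j<k)

    above-P : ∀ {s} → s < P₁ → p P ≤ p s
    above-P {s} s<P₁ with s ≟ P
    ... | yes refl = ℕₚ.≤-refl
    ... | no s≢P = ℕₚ.<⇒≤ (before-LRMin ¬nl-P (⋖-below P⋖P₁ s<P₁ s≢P))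

    switch-or-contradict : Dec (NonLRMin π P₁) → Improvement π
    -- If P₁ is no minimum, P is its witness for an edge to j while P₁ has no
    -- edge to k: an exclusive neighbour of j.
    switch-or-contradict (yes (t , t<P₁ , pt<pP₁)) = ⊥-elim (no-exclusive (P₁ , P₁j , ¬P₁k , <⇒≢ P₁<k))
      where
      P<j : P < j
      P<j = ℕₚ.<-trans P<P₁ (ℕₚ.≤-<-trans P₁≤i i<j)
      P₁j : CAdj π P₁ j
      P₁j = (λ { refl → ℕₚ.<-irrefl refl (ℕₚ.≤-<-trans P₁≤i i<j) }) , P , P<P₁ , P<j ,
            ℕₚ.≤-<-trans (above-P t<P₁) pt<pP₁ , ≤∧≢⇒< pP≤pj (<⇒≢ P<j ∘′ π-injective)
      ¬P₁k : ¬ CAdj π P₁ k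
      ¬P₁k (_ , s , s<P₁ , _ , _ , ps<pk) = ℕₚ.<-irrefl refl (ℕₚ.≤-<-trans (above-P s<P₁) (ℕₚ.<-trans ps<pk pk<pP))
    -- If P₁ is a minimum, it witnesses the edges from Q needed for the switch.
    switch-or-contradict (no ¬nl-P₁) = improvement swapped (same-graph Q-reaches) potential-increases
      where
      P<Q : P < Q
      P<Q = LRMin-precedes-smaller ¬nl-P (⋖⇒< pQ⋖pP)
      open ValueSwitch π pQ⋖pP refl refl P<Q
      pP₁<pP : p P₁ < p P
      pP₁<pP = before-LRMin ¬nl-P₁ P<P₁
      Q-reaches : ∀ v → P < v → v ≢ Q → p P < p v → CAdj π Q v
      Q-reaches v P<v v≢Q pP<pv =
        v≢Q ∘′ ≡.sym , P₁ ,
        ⋖-above P⋖P₁ P<Q (λ Q≡P₁ → ¬nl-P₁ (subst (NonLRMin π) Q≡P₁ nl-Q)) ,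
        ⋖-above P⋖P₁ P<v (λ { refl → ℕₚ.<-asym pP₁<pP pP<pv }) ,
        ⋖-below pQ⋖pP pP₁<pP (λ e → ¬nl-P₁ (subst (NonLRMin π) (≡.sym (π-injective e)) nl-Q)) ,
        ℕₚ.<-trans pP₁<pP pP<pv

  progress : Contains132 π → ¬ HasInducedP3 (C π) → Improvement π
  progress (i , j , k , i<j , j<k , pi<pk , pk<pj) no-P3 with switchable-descent? | switchable-inversion?
  ... | yes descent | _ = switch-descent descent
  ... | no _ | yes inversion = switch-inversion inversion
  ... | no no-descent | no no-inversion with exclusive-neighbour? k j | exclusive-neighbour? j k
  ...   | no none | _ = position-switch no-descent i<j j<k pi<pk pk<pj none
  ...   | yes _ | no none = value-switch no-inversion i<j j<k pi<pk pk<pj none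
  ...   | yes at-k | yes at-j = ⊥-elim (no-P3 (exclusive-neighbours⇒P3 jk at-j at-k))
    where
    jk : CAdj π j k
    jk = <⇒≢ j<k , i , i<j , ℕₚ.<-trans i<j j<k , ℕₚ.<-trans pi<pk pk<pj , pi<pk

contains132? : ∀ {n} (π : Permutation′ n) → Dec (Contains132 π)
contains132? π = any? λ i → any? λ j → any? λ k →
  (i <? j) ×-dec ((j <? k) ×-dec ((π ⟨$⟩ʳ i <? π ⟨$⟩ʳ k) ×-dec (π ⟨$⟩ʳ k <? π ⟨$⟩ʳ j)))

-- Improving while a 132 pattern remains terminates, since the potential is
-- bounded by n³; the result is a 132-avoider with isomorphic graph.
avoiding-representative : ∀ {n} (π : Permutation′ n) → ¬ HasInducedP3 (C π) →
                          ∃ λ σ → Avoids132 σ × C π ≅ C σ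
avoiding-representative {n} π = improve π (<-wellFounded (n * (n * n) ∸ potential π))
  where
  improve : ∀ π → Acc ℕ._<_ (n * (n * n) ∸ potential π) → ¬ HasInducedP3 (C π) →
            ∃ λ σ → Avoids132 σ × C π ≅ C σ
  improve π (acc smaller) no-P3 with contains132? π
  ... | no avoids = π , avoids , ≅-refl {C π}
  ... | yes occurrence with Progress.progress π occurrence no-P3
  ...   | improvement π′ π≅π′ increases
    with improve π′ (smaller (ℕₚ.∸-monoʳ-< increases (potential-bounded π′)))
                 (no-P3 ∘′ P3-transfer {C π′} {C π} (≅-sym {C π} {C π′} π≅π′))
  ...     | σ , avoids , π′≅σ = σ , avoids , ≅-trans {C π} {C π′} {C σ} π≅π′ π′≅σ

mainTheorem6 : (n : ℕ) (G : Graph) (π : Permutation′ n) → G ≅ C π →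
  ((∃ λ (σ : Permutation′ n) → Avoids132 σ × G ≅ C σ) ⇔ (¬ HasInducedP3 G))
mainTheorem6 n G π G≅Cπ = mk⇔ only-if if-P3-free
  where
  only-if : (∃ λ σ → Avoids132 σ × G ≅ C σ) → ¬ HasInducedP3 G
  only-if (σ , avoids , G≅Cσ) = Adjacency.avoider⇒P3-free σ avoids ∘′ P3-transfer {G} {C σ} G≅Cσ
  if-P3-free : ¬ HasInducedP3 G → ∃ λ σ → Avoids132 σ × G ≅ C σ
  if-P3-free no-P3 with avoiding-representative π (no-P3 ∘′ P3-transfer {C π} {G} (≅-sym {G} {C π} G≅Cπ))
  ... | σ , avoids , Cπ≅Cσ = σ , avoids , ≅-trans {G} {C π} {C σ} G≅Cπ Cπ≅Cσ
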